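{- Let $G$ be a strongly connected simple directed graph and $f:V\to[n]$ any valuation of $G$. Then in the Markov chain of possibilities of $G$ there is a directed path from $f$ to some constant valuation $f_{con}$.
   Context: Let $G=(V,E)$ be a finite simple directed graph with $n=|V|$ vertices and $[n]=\{1,\dots,n\}$. A valuation is a function $f:V\to[n]$; it is constant if it takes the same value at every vertex. The asynchronous maximum model: given $f_t$, choose $v'\in V$ uniformly at random; set $f_{t+1}(v')=\max\{f_t(u): u\neq v',\ (v',u)\in E\}$ if $v'$ has an out-neighbour (unchanged otherwise), and $f_{t+1}(v)=f_t(v)$ for $v\neq v'$. The Markov chain of possibilities is the directed graph (loops allowed) whose vertices are all valuations $V\to[n]$, with an edge $f\to g$ whenever the one-round transition probability from $f$ to $g$ is positive. -}

module Defs where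

open import Data.Nat using (ℕ; _≤_)
open import Data.Fin using (Fin; toℕ)
open import Data.Bool using (Bool; true; false)
open import Data.Product using (Σ; ∃; _×_; _,_)
open import Data.Sum using (_⊎_)
open import Relation.Nullary using (¬_)
open import Relation.Binary.PropositionalEquality using (_≡_; _≢_)
open import Relation.Binary.Construct.Closure.ReflexiveTransitive using (Star)

record Digraph (n : ℕ) : Set where
  field
    adj   : Fin n → Fin n → Bool
    loopless : ∀ v → adj v v ≡ false

open Digraph public

Edge : ∀ {n} → Digraph n → Fin n → Fin n → Set
Edge G u v = adj G u v ≡ true

StronglyConnected : ∀ {n} → Digraph n → Set
StronglyConnected G = ∀ u v → Star (Edge G) u v

-- Valuations V → [n]; [n] = {1..n} is represented by Fin n = {0..n-1}
-- (an order-preserving relabelling, irrelevant for max and constancy).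
Valuation : ℕ → Set
Valuation n = Fin n → Fin n

Constant : ∀ {n} → Valuation n → Set
Constant {n} f = ∀ u v → f u ≡ f v

HasOutNeighbour : ∀ {n} → Digraph n → Fin n → Set
HasOutNeighbour G v = ∃ λ u → u ≢ v × Edge G v u

IsMaxOut : ∀ {n} → Digraph n → Valuation n → Fin n → Fin n → Set
IsMaxOut G f v m =
  (∃ λ u → u ≢ v × Edge G v u × f u ≡ m) ×
  (∀ u → u ≢ v → Edge G v u → toℕ (f u) ≤ toℕ m)

UpdateAt : ∀ {n} → Digraph n → Valuation n → Fin n → Valuation n → Set
UpdateAt G f v' g =
  (∀ w → w ≢ v' → g w ≡ f w) ×
  ((HasOutNeighbour G v' × IsMaxOut G f v' (g v')) ⊎
   (¬ HasOutNeighbour G v' × g v' ≡ f v'))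

-- Edge f → g of the Markov chain of possibilities: the one-round transition
-- probability is positive, i.e. some choice of v' (each has probability 1/n)
-- produces g.
Step : ∀ {n} → Digraph n → Valuation n → Valuation n → Set
Step G f g = ∃ λ v' → UpdateAt G f v' g

Reachable : ∀ {n} → Digraph n → Valuation n → Valuation n → Set
Reachable G = Star (Step G)

-- Let M be the largest value of f, attained at a vertex m. No update can
-- create a value above M, since a vertex only copies the value of an
-- out-neighbour. If w already holds M and v → w is an edge, updating v
-- therefore sets v to M. Walking back along a path from v to m, M spreads
-- vertex by vertex without ever being lost at m; by strong connectivity every
-- vertex has such a path, so flooding all vertices in turn reaches the
-- constant valuation M.
module Submission where

open import Defs
open import Data.Nat using (ℕ; zero; suc; _≤_)
open import Data.Fin using (Fin; toℕ; _≟_)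
open import Data.Fin.Patterns using (0F)
open import Data.Vec.Functional using (updateAt)
open import Data.Vec.Functional.Properties using (updateAt-updates; updateAt-minimal)
open import Data.List using (List; []; _∷_; allFin)
open import Data.List.Relation.Unary.All as All using (All; []; _∷_)
open import Data.List.Membership.Propositional.Properties using (∈-allFin)
open import Data.List.Extrema.Nat using (argmax; f[xs]≤f[argmax])
open import Data.Product using (∃; _×_; _,_)
open import Data.Sum using (inj₁; inj₂)
open import Function using (const; _∘_)
open import Relation.Nullary using (yes; no)
open import Relation.Binary.PropositionalEquality
open import Relation.Binary.Construct.Closure.ReflexiveTransitive using (Star; ε; _◅_; _◅◅_)

edge⇒≢ : ∀ {n} (G : Digraph n) {v w} → Edge G v w → w ≢ v
edge⇒≢ G {v} e refl with trans (sym e) (loopless G v)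
... | ()

module Flooding {n : ℕ} (G : Digraph n) (M : Fin n) where

  BelowM : Fin n → Set
  BelowM x = toℕ x ≤ toℕ M

  BoundedByM : Valuation n → Set
  BoundedByM g = ∀ u → BelowM (g u)

  _⊑_ : Valuation n → Valuation n → Set
  g ⊑ h = ∀ x → g x ≡ M → h x ≡ M

  ⊑-trans : ∀ {g h k} → g ⊑ h → h ⊑ k → g ⊑ k
  ⊑-trans g⊑h h⊑k x gx = h⊑k x (g⊑h x gx)

  step-preserves-bound : ∀ {g h} → Step G g h → BoundedByM g → BoundedByM h
  step-preserves-bound (v , unchanged , updated) g≤M w with w ≟ v
  ... | no w≢v = subst BelowM (sym (unchanged w w≢v)) (g≤M w)
  ... | yes refl with updated
  ...   | inj₁ (_ , (u , _ , _ , gu≡hv) , _) = subst BelowM gu≡hv (g≤M u)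
  ...   | inj₂ (_ , hv≡gv)                   = subst BelowM (sym hv≡gv) (g≤M v)

  reachable-preserves-bound : ∀ {g h} → Reachable G g h → BoundedByM g → BoundedByM h
  reachable-preserves-bound ε         g≤M = g≤M
  reachable-preserves-bound (s ◅ ss) g≤M =
    reachable-preserves-bound ss (step-preserves-bound s g≤M)

  raise : Fin n → Valuation n → Valuation n
  raise v g = updateAt g v (const M)

  ⊑-raise : ∀ v g → g ⊑ raise v g
  ⊑-raise v g x gx with x ≟ v
  ... | yes refl = updateAt-updates v g
  ... | no x≢v   = trans (updateAt-minimal x v g x≢v) gx

  raise-step : ∀ {g v w} → Edge G v w → g w ≡ M → BoundedByM g → Step G g (raise v g)
  raise-step {g} {v} {w} e gw≡M g≤M =
    v , (λ x x≢v → updateAt-minimal x v g x≢v) ,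
    inj₁ ((w , w≢v , e) , (w , w≢v , e , trans gw≡M (sym raised)) , max-bound)
    where
    w≢v : w ≢ v
    w≢v = edge⇒≢ G e
    raised : raise v g v ≡ M
    raised = updateAt-updates v g
    max-bound : ∀ u → u ≢ v → Edge G v u → toℕ (g u) ≤ toℕ (raise v g v)
    max-bound u _ _ = subst (λ z → toℕ (g u) ≤ toℕ z) (sym raised) (g≤M u)

  flood-path : ∀ {v m g} → Star (Edge G) v m → BoundedByM g → g m ≡ M →
    ∃ λ h → Reachable G g h × g ⊑ h × h v ≡ M
  flood-path {g = g} ε _ gm≡M = g , ε , (λ _ gx → gx) , gm≡M
  flood-path {v} (e ◅ path) g≤M gm≡M with flood-path path g≤M gm≡M
  ... | h , g↝h , g⊑h , hw≡M =
    raise v h ,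
    g↝h ◅◅ (raise-step e hw≡M (reachable-preserves-bound g↝h g≤M) ◅ ε) ,
    ⊑-trans g⊑h (⊑-raise v h) ,
    updateAt-updates v h

  flood-all : ∀ {m g} → (∀ v → Star (Edge G) v m) → (vs : List (Fin n)) →
    BoundedByM g → g m ≡ M → ∃ λ h → Reachable G g h × g ⊑ h × All (λ x → h x ≡ M) vs
  flood-all {g = g} _ [] _ _ = g , ε , (λ _ gx → gx) , []
  flood-all {m} paths (v ∷ vs) g≤M gm≡M with flood-all paths vs g≤M gm≡M
  ... | h , g↝h , g⊑h , vs≡M
    with flood-path (paths v) (reachable-preserves-bound g↝h g≤M) (g⊑h m gm≡M)
  ...   | k , h↝k , h⊑k , kv≡M =
    k , g↝h ◅◅ h↝k , ⊑-trans g⊑h h⊑k , kv≡M ∷ All.map (h⊑k _) vs≡M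

argmax-Fin : ∀ {k} (f : Fin (suc k) → ℕ) → ∃ λ m → ∀ u → f u ≤ f m
argmax-Fin {k} f =
  argmax f 0F (allFin (suc k)) ,
  λ u → All.lookup (f[xs]≤f[argmax] {f = f} 0F (allFin (suc k))) (∈-allFin u)

everywhere⇒Constant : ∀ {n} {g : Valuation n} {c : Fin n} →
  All (λ x → g x ≡ c) (allFin n) → Constant g
everywhere⇒Constant g≡c u v =
  trans (All.lookup g≡c (∈-allFin u)) (sym (All.lookup g≡c (∈-allFin v)))

mainTheorem13 : ∀ {n : ℕ} (G : Digraph n) → StronglyConnected G →
    (f : Valuation n) → ∃ λ fcon → Constant fcon × Reachable G f fcon
mainTheorem13 {zero}  G sc f = f , (λ ()) , ε
mainTheorem13 {suc k} G sc f with argmax-Fin (toℕ ∘ f)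
... | m , f≤M with Flooding.flood-all G (f m) (λ v → sc v m) (allFin (suc k)) f≤M refl
...   | h , f↝h , _ , h≡M = h , everywhere⇒Constant h≡M , f↝h
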